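{- For every positive integer $m$ and every integer $n\geq 2$, the cylinder $C(2m,2n)$ is interval colorable and $W(C(2m,2n))\geq 4m+2n-2$. For all positive integers $m,n$, the cylinder $C(2m,2n+1)$ is interval colorable and $W(C(2m,2n+1))\geq 4m+2n-1$.
   Context: All graphs are finite, undirected, without loops or multiple edges. An edge-coloring of a graph $G$ with colors $1,\ldots,t$ is an interval $t$-coloring if all $t$ colors are used, and the colors of the edges incident to each vertex are distinct and form an interval of consecutive integers. A graph is interval colorable if it has an interval $t$-coloring for some positive integer $t$; for such a graph, $W(G)$ is the greatest such $t$. The cylinder $C(a,b)$ is the Cartesian product $P_a\square C_b$ of the path on $a$ vertices and the cycle on $b$ vertices. The Cartesian product $G\square H$ has vertex set $V(G)\times V(H)$, with $(u_1,v_1)(u_2,v_2)$ an edge iff either $u_1=u_2$ and $v_1v_2\in E(H)$, or $v_1=v_2$ and $u_1u_2\in E(G)$. -}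

module Defs where

open import Data.Nat using (ℕ; zero; suc; _+_; _∸_; _≤_)
open import Data.Fin using (Fin; toℕ)
open import Data.Product using (Σ; _×_; _,_; ∃; ∃-syntax)
open import Data.Sum using (_⊎_)
open import Relation.Binary.PropositionalEquality using (_≡_)

record Graph : Set₁ where
  field
    V   : Set
    Adj : V → V → Set
open Graph public

Path : ℕ → Graph
Path a = record
  { V   = Fin a
  ; Adj = λ i j → (toℕ j ≡ suc (toℕ i)) ⊎ (toℕ i ≡ suc (toℕ j)) }

-- Cycle C_b on vertices 0..b-1 (used for b ≥ 3): i ~ j iff j = i+1 mod b
-- or i = j+1 mod b.
CycStep : (b : ℕ) → Fin b → Fin b → Set
CycStep b i j = (toℕ j ≡ suc (toℕ i)) ⊎ ((toℕ i ≡ b ∸ 1) × (toℕ j ≡ 0))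

Cycle : ℕ → Graph
Cycle b = record
  { V   = Fin b
  ; Adj = λ i j → CycStep b i j ⊎ CycStep b j i }

_□_ : Graph → Graph → Graph
G □ H = record
  { V   = V G × V H
  ; Adj = λ p q → let (u₁ , v₁) = p ; (u₂ , v₂) = q in
      ((u₁ ≡ u₂) × Adj H v₁ v₂) ⊎ ((v₁ ≡ v₂) × Adj G u₁ u₂) }

Cyl : ℕ → ℕ → Graph
Cyl a b = Path a □ Cycle b

record EdgeColoring (G : Graph) : Set where
  field
    col : (u v : V G) → Adj G u v → ℕ
    col-sym : ∀ u v (e : Adj G u v) (e' : Adj G v u) → col u v e ≡ col v u e'
open EdgeColoring public

record IsIntervalColoring (G : Graph) (t : ℕ) (c : EdgeColoring G) : Set where
  field
    inRange : ∀ u v (e : Adj G u v) → 1 ≤ col c u v e × col c u v e ≤ t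
    allUsed : ∀ k → 1 ≤ k → k ≤ t → Σ (V G) λ u → Σ (V G) λ v → Σ (Adj G u v) λ e → col c u v e ≡ k
    proper  : ∀ u v w (e : Adj G u v) (e' : Adj G u w) → col c u v e ≡ col c u w e' → v ≡ w
    interval : ∀ u v w (e : Adj G u v) (e' : Adj G u w) k →
               col c u v e ≤ k → k ≤ col c u w e' →
               Σ (V G) λ x → Σ (Adj G u x) λ e'' → col c u x e'' ≡ k

HasIntervalColoring : Graph → ℕ → Set
HasIntervalColoring G t = Σ (EdgeColoring G) (IsIntervalColoring G t)

IntervalColorable : Graph → Set
IntervalColorable G = Σ ℕ λ t → (1 ≤ t) × HasIntervalColoring G t

-- W(G) ≥ k  (W(G) = greatest t with an interval t-colouring)
W≥ : Graph → ℕ → Set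
W≥ G k = Σ ℕ λ t → (k ≤ t) × HasIntervalColoring G t

module Submission where

-- Split the 2m rows of C(2m,b) into m blocks of two consecutive rows.  A
-- pattern for the cycle length b is an interval t₀-colouring of the prism
-- C(2,b) in which both rows carry the same horizontal colours and the three
-- edges at column j receive exactly the window {s_j, s_j+1, s_j+2} ⊆ [1,t₀],
-- every colour of [1,t₀] lying in some window.  Stacking m copies, block h
-- shifted by 4h, and colouring the edge between blocks h and h+1 at column j
-- by s_j + 4h + 3, every vertex sees its shifted window plus one colour just
-- below it (lower row of a block) or just above it (upper row): this is an
-- interval (t₀ + 4(m-1))-colouring of C(2m,b).  Explicit patterns with
-- t₀ = 2n+2 for b = 2n and t₀ = 2n+3 for b = 2n+1 give the two bounds.

open import Defs
open import Data.Bool using (Bool; true; false; T; if_then_else_)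
open import Data.Empty using (⊥; ⊥-elim)
open import Data.Fin using (Fin; toℕ; fromℕ<; fromℕ; inject₁) renaming (zero to fzero; suc to fsuc)
open import Data.Fin.Patterns using (0F; 1F; 2F)
open import Data.Fin.Permutation using (Permutation′; _⟨$⟩ʳ_; _⟨$⟩ˡ_; inverseˡ; inverseʳ; id; transpose; reverse; _∘ₚ_)
open import Data.Fin.Properties using (toℕ-injective; toℕ-fromℕ<; toℕ-fromℕ; toℕ-inject₁; toℕ<n)
open import Data.Nat using (ℕ; zero; suc; pred; _+_; _*_; _∸_; _≤_; _<_; z≤n; s≤s; s≤s⁻¹; _<?_; _≤?_; _<ᵇ_; ⌊_/2⌋)
open import Data.Nat.DivMod using (_%_; m<n⇒m%n≡m; n%n≡0)
open import Data.Nat.Properties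
open import Data.Nat.Tactic.RingSolver using (solve-∀)
open import Data.Product using (Σ; _×_; _,_; proj₁; proj₂)
open import Data.Product.Properties using (,-injectiveˡ; ,-injectiveʳ)
open import Data.Sum using (_⊎_; inj₁; inj₂)
open import Data.Unit using (⊤; tt)
open import Relation.Binary.PropositionalEquality
open import Relation.Binary.Definitions using (tri<; tri≈; tri>)
open import Relation.Nullary using (yes; no)

-- The edges at a vertex are indexed by A, those satisfying Present being the
-- ones that exist.
record Ranked {A : Set} (Present : A → Set) (colour : A → ℕ) : Set where
  field
    base           : ℕ
    rank           : A → ℕ
    injective      : ∀ d d′ → rank d ≡ rank d′ → d ≡ d′
    convex         : ∀ d d′ x → Present d → Present d′ → rank d ≤ x → x ≤ rank d′ →
                     Σ A λ d″ → Present d″ × rank d″ ≡ x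
    colour-rank    : ∀ d → Present d → suc (colour d) ≡ base + rank d

ranked-injective : ∀ {A} {Present : A → Set} {colour : A → ℕ} → Ranked Present colour →
                   ∀ d d′ → Present d → Present d′ → colour d ≡ colour d′ → d ≡ d′
ranked-injective {colour = colour} ρ d d′ pd pd′ same = injective d d′ (+-cancelˡ-≡ base _ _ (begin
    base + rank d    ≡⟨ colour-rank d pd ⟨
    suc (colour d)   ≡⟨ cong suc same ⟩
    suc (colour d′)  ≡⟨ colour-rank d′ pd′ ⟩
    base + rank d′   ∎))
  where
  open Ranked ρ
  open ≡-Reasoning

ranked-interval : ∀ {A} {Present : A → Set} {colour : A → ℕ} → Ranked Present colour →
                  ∀ d d′ k → Present d → Present d′ → colour d ≤ k → k ≤ colour d′ →
                  Σ A λ d″ → Present d″ × colour d″ ≡ k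
ranked-interval {A} {Present} {colour} ρ d d′ k pd pd′ lo hi = d″ , pd″ , suc-injective (begin
    suc (colour d″)        ≡⟨ colour-rank d″ pd″ ⟩
    base + rank d″         ≡⟨ cong (base +_) (proj₂ (proj₂ found)) ⟩
    base + (suc k ∸ base)  ≡⟨ m+[n∸m]≡n (≤-trans (m≤m+n base (rank d)) from) ⟩
    suc k                  ∎)
  where
  open Ranked ρ
  open ≡-Reasoning
  from : base + rank d ≤ suc k
  from = subst (_≤ suc k) (colour-rank d pd) (s≤s lo)
  to : suc k ≤ base + rank d′
  to = subst (suc k ≤_) (colour-rank d′ pd′) (s≤s hi)
  found : Σ A λ d″ → Present d″ × rank d″ ≡ suc k ∸ base
  found = convex d d′ (suc k ∸ base) pd pd′
            (m+n≤o⇒m≤o∸n (rank d) (subst (_≤ suc k) (+-comm base (rank d)) from))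
            (m≤n+o⇒m∸n≤o (suc k) base to)
  d″ : A
  d″ = proj₁ found
  pd″ : Present d″
  pd″ = proj₁ (proj₂ found)

-- The four directions at a vertex: along the cycle (L, R) and along the path (U, D).
data Dir : Set where
  L R U D : Dir

-- At a vertex the three
-- slots 0F (left edge), 1F (right edge) and 2F (the rung, i.e. the vertical
-- edge inside the block) carry its window; the remaining outer edge leaves
-- the block.
slotDir : Bool → Fin 3 → Dir
slotDir _     0F = L
slotDir _     1F = R
slotDir false 2F = D
slotDir true  2F = U

outer : Bool → Dir
outer false = U
outer true  = D

slot-present : ∀ p (Present : Dir → Set) → Present L → Present R → Present (slotDir p 2F) →
               ∀ k → Present (slotDir p k)
slot-present _     Present pL pR pRung 0F = pL
slot-present _     Present pL pR pRung 1F = pR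
slot-present false Present pL pR pRung 2F = pRung
slot-present true  Present pL pR pRung 2F = pRung

-- An arrangement places the three slots at offsets 0, 1, 2 of the window.
Arrangement : Set
Arrangement = Permutation′ 3

pos : Arrangement → Fin 3 → ℕ
pos π k = toℕ (π ⟨$⟩ʳ k)

slot-at : ∀ π o → o < 3 → Σ (Fin 3) λ k → pos π k ≡ o
slot-at π o o<3 = π ⟨$⟩ˡ fromℕ< o<3 , trans (cong toℕ (inverseʳ π)) (toℕ-fromℕ< o<3)

-- Rank of a direction at a vertex of a lower (false) or upper (true) row:
-- slots have rank 1 + offset, the outer edge lies just below (rank 0) or
-- just above (rank 4) the window.
rank : Bool → Arrangement → Dir → ℕ
rank _     π L = suc (pos π 0F)
rank _     π R = suc (pos π 1F)
rank false π U = 0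
rank false π D = suc (pos π 2F)
rank true  π U = suc (pos π 2F)
rank true  π D = 4

slot-rank : ∀ p π k → rank p π (slotDir p k) ≡ suc (pos π k)
slot-rank _     π 0F = refl
slot-rank _     π 1F = refl
slot-rank false π 2F = refl
slot-rank true  π 2F = refl

dirAt : Bool → Arrangement → ℕ → Dir
dirAt p π 1 = slotDir p (π ⟨$⟩ˡ 0F)
dirAt p π 2 = slotDir p (π ⟨$⟩ˡ 1F)
dirAt p π 3 = slotDir p (π ⟨$⟩ˡ 2F)
dirAt p π _ = outer p

dirAt-slot : ∀ p π k → dirAt p π (suc (toℕ (π ⟨$⟩ʳ k))) ≡ slotDir p k
dirAt-slot p π k with π ⟨$⟩ʳ k | inverseˡ π {k}
... | 0F | back = cong (slotDir p) back
... | 1F | back = cong (slotDir p) back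
... | 2F | back = cong (slotDir p) back

dirAt-rank : ∀ p π d → dirAt p π (rank p π d) ≡ d
dirAt-rank _     π L = dirAt-slot _ π 0F
dirAt-rank _     π R = dirAt-slot _ π 1F
dirAt-rank false π U = refl
dirAt-rank false π D = dirAt-slot false π 2F
dirAt-rank true  π U = dirAt-slot true π 2F
dirAt-rank true  π D = refl

rank-injective : ∀ p π d d′ → rank p π d ≡ rank p π d′ → d ≡ d′
rank-injective p π d d′ same =
  trans (sym (dirAt-rank p π d)) (trans (cong (dirAt p π) same) (dirAt-rank p π d′))

rank-lower : ∀ p π d → 1 ≤ rank p π d ⊎ (p ≡ false × d ≡ U)
rank-lower _     π L = inj₁ (s≤s z≤n)
rank-lower _     π R = inj₁ (s≤s z≤n)
rank-lower false π U = inj₂ (refl , refl)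
rank-lower false π D = inj₁ (s≤s z≤n)
rank-lower true  π U = inj₁ (s≤s z≤n)
rank-lower true  π D = inj₁ (s≤s z≤n)

rank-upper : ∀ p π d → rank p π d ≤ 3 ⊎ (p ≡ true × d ≡ D)
rank-upper _     π L = inj₁ (toℕ<n (π ⟨$⟩ʳ 0F))
rank-upper _     π R = inj₁ (toℕ<n (π ⟨$⟩ʳ 1F))
rank-upper false π U = inj₁ z≤n
rank-upper false π D = inj₁ (toℕ<n (π ⟨$⟩ʳ 2F))
rank-upper true  π U = inj₁ (toℕ<n (π ⟨$⟩ʳ 2F))
rank-upper true  π D = inj₂ (refl , refl)

rank≤4 : ∀ p π d → rank p π d ≤ 4
rank≤4 p π d with rank-upper p π d
... | inj₁ ≤3           = m≤n⇒m≤1+n ≤3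
... | inj₂ (refl , refl) = ≤-refl

rank-convex : ∀ p π (Present : Dir → Set) → Present L → Present R → Present (slotDir p 2F) →
              ∀ d d′ x → Present d → Present d′ → rank p π d ≤ x → x ≤ rank p π d′ →
              Σ Dir λ d″ → Present d″ × rank p π d″ ≡ x
rank-convex p π Present pL pR pRung d d′ zero pd pd′ lo hi = d , pd , n≤0⇒n≡0 lo
rank-convex p π Present pL pR pRung d d′ (suc o) pd pd′ lo hi with o <? 3
... | yes o<3 = slotDir p k , slot-present p Present pL pR pRung k ,
                trans (slot-rank p π k) (cong suc (proj₂ (slot-at π o o<3)))
  where
  k : Fin 3
  k = proj₁ (slot-at π o o<3)
... | no o≮3 = d′ , pd′ , ≤-antisym (≤-trans (rank≤4 p π d′) (s≤s (≮⇒≥ o≮3))) hi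

prevCol : ℕ → ℕ → ℕ
prevCol b zero    = b ∸ 1
prevCol b (suc j) = j

module CylinderGeometry (a b′ : ℕ) where

  b : ℕ
  b = suc (suc (suc b′))

  G : Graph
  G = Cyl a b

  step-prev : ∀ {j j′ : Fin b} → CycStep b j j′ → prevCol b (toℕ j′) ≡ toℕ j
  step-prev (inj₁ next)           = cong (prevCol b) next
  step-prev (inj₂ (last , first)) = trans (cong (prevCol b) first) (sym last)

  step-next : ∀ {j j′ : Fin b} → CycStep b j j′ → toℕ j′ ≡ suc (toℕ j) % b
  step-next {j′ = j′} (inj₁ next) = trans next (sym (m<n⇒m%n≡m (subst (_< b) next (toℕ<n j′))))
  step-next (inj₂ (last , first)) = trans first (sym (trans (cong (λ x → suc x % b) last) (n%n≡0 b)))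

  -- Since b ≥ 3, a step never goes back and forth, and never stays put.
  step-asym : ∀ {j j′ : Fin b} → CycStep b j j′ → CycStep b j′ j → ⊥
  step-asym (inj₁ p)         (inj₁ q)         = m+1+n≢n 1 (sym (trans p (cong suc q)))
  step-asym (inj₁ p)         (inj₂ (q₁ , q₂)) = 1+n≢0 (suc-injective (trans (sym q₁) (trans p (cong suc q₂))))
  step-asym (inj₂ (p₁ , p₂)) (inj₁ q)         = 1+n≢0 (suc-injective (trans (sym p₁) (trans q (cong suc p₂))))
  step-asym (inj₂ (p₁ , _))  (inj₂ (_ , q₂))  = 1+n≢0 (trans (sym p₁) q₂)

  step-irrefl : ∀ {j : Fin b} → CycStep b j j → ⊥
  step-irrefl (inj₁ p)       = 1+n≢n (sym p)
  step-irrefl (inj₂ (p , q)) = 1+n≢0 (trans (sym p) q)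

  row column : V G → ℕ
  row    u = toℕ (proj₁ u)
  column u = toℕ (proj₂ u)

  Present : ℕ → Dir → Set
  Present i L = ⊤
  Present i R = ⊤
  Present i U = 1 ≤ i
  Present i D = suc i < a

  dir : ∀ {u v} → Adj G u v → Dir
  dir (inj₁ (_ , inj₁ _)) = R
  dir (inj₁ (_ , inj₂ _)) = L
  dir (inj₂ (_ , inj₁ _)) = D
  dir (inj₂ (_ , inj₂ _)) = U

  dir-present : ∀ u v (e : Adj G u v) → Present (row u) (dir e)
  dir-present u       v        (inj₁ (_ , inj₁ _)) = tt
  dir-present u       v        (inj₁ (_ , inj₂ _)) = tt
  dir-present u       (i′ , _) (inj₂ (_ , inj₁ p)) = subst (_< a) p (toℕ<n i′)
  dir-present u       v        (inj₂ (_ , inj₂ p)) = subst (1 ≤_) (sym p) (s≤s z≤n)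

  target : ℕ → ℕ → Dir → ℕ × ℕ
  target i j L = i , prevCol b j
  target i j R = i , suc j % b
  target i j U = pred i , j
  target i j D = suc i , j

  coords : V G → ℕ × ℕ
  coords u = row u , column u

  coords-injective : ∀ u v → coords u ≡ coords v → u ≡ v
  coords-injective u v same =
    cong₂ _,_ (toℕ-injective (,-injectiveˡ same)) (toℕ-injective (,-injectiveʳ same))

  target-coords : ∀ u v (e : Adj G u v) → coords v ≡ target (row u) (column u) (dir e)
  target-coords (i , j) _ (inj₁ (refl , inj₁ s)) = cong (toℕ i ,_) (step-next s)
  target-coords (i , j) _ (inj₁ (refl , inj₂ s)) = cong (toℕ i ,_) (sym (step-prev s))
  target-coords (i , j) _ (inj₂ (refl , inj₁ p)) = cong (_, toℕ j) p
  target-coords (i , j) _ (inj₂ (refl , inj₂ p)) = cong (_, toℕ j) (cong pred (sym p))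

  dir-injective : ∀ u v w (e : Adj G u v) (e′ : Adj G u w) → dir e ≡ dir e′ → v ≡ w
  dir-injective u v w e e′ same = coords-injective v w (begin
    coords v                              ≡⟨ target-coords u v e ⟩
    target (row u) (column u) (dir e)     ≡⟨ cong (target (row u) (column u)) same ⟩
    target (row u) (column u) (dir e′)    ≡⟨ target-coords u w e′ ⟨
    coords w                              ∎)
    where open ≡-Reasoning

  neighbour : ∀ u d → Present (row u) d → Σ (V G) λ v → Σ (Adj G u v) λ e → dir e ≡ d
  neighbour (i , j) R _ with suc (toℕ j) <? b
  ... | yes j+1<b = (i , fromℕ< j+1<b) , inj₁ (refl , inj₁ (inj₁ (toℕ-fromℕ< j+1<b))) , refl
  ... | no j+1≮b  = (i , fzero) , inj₁ (refl , inj₁ (inj₂ (last , refl))) , refl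
    where
    last : toℕ j ≡ suc (suc b′)
    last = suc-injective (≤-antisym (toℕ<n j) (≮⇒≥ j+1≮b))
  neighbour (i , fzero)  L _ =
    (i , fromℕ (suc (suc b′))) , inj₁ (refl , inj₂ (inj₂ (toℕ-fromℕ _ , refl))) , refl
  neighbour (i , fsuc j) L _ =
    (i , inject₁ j) , inj₁ (refl , inj₂ (inj₁ (cong suc (sym (toℕ-inject₁ j))))) , refl
  neighbour (i , j) D below = (fromℕ< below , j) , inj₂ (refl , inj₁ (toℕ-fromℕ< below)) , refl
  neighbour (i , j) U above = (fromℕ< i-1<a , j) , inj₂ (refl , inj₂ up) , refl
    where
    i-1<a : toℕ i ∸ 1 < a
    i-1<a = ≤-<-trans (m∸n≤m (toℕ i) 1) (toℕ<n i)
    up : toℕ i ≡ suc (toℕ (fromℕ< i-1<a))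
    up = trans (+-∸-assoc 1 above) (cong suc (sym (toℕ-fromℕ< i-1<a)))

  module DirectionColouring (κ : ℕ → ℕ → Dir → ℕ)
      (κ-hor : ∀ i (j j′ : Fin b) → CycStep b j j′ → κ i (toℕ j) R ≡ κ i (toℕ j′) L)
      (κ-ver : ∀ i j → κ i j D ≡ κ (suc i) j U) where

    colour : (u v : V G) → Adj G u v → ℕ
    colour u _ e = κ (row u) (column u) (dir e)

    colour-sym : ∀ u v (e : Adj G u v) (e′ : Adj G v u) → colour u v e ≡ colour v u e′
    colour-sym (i , j) _ (inj₁ (refl , inj₁ s)) (inj₁ (_ , inj₁ s′)) = ⊥-elim (step-asym s s′)
    colour-sym (i , j) _ (inj₁ (refl , inj₁ s)) (inj₁ (_ , inj₂ _))  = κ-hor (toℕ i) j _ s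
    colour-sym (i , j) _ (inj₁ (refl , inj₂ s)) (inj₁ (_ , inj₁ _))  = sym (κ-hor (toℕ i) _ j s)
    colour-sym (i , j) _ (inj₁ (refl , inj₂ s)) (inj₁ (_ , inj₂ s′)) = ⊥-elim (step-asym s s′)
    colour-sym _ _ (inj₁ (_ , inj₁ s)) (inj₂ (refl , _)) = ⊥-elim (step-irrefl s)
    colour-sym _ _ (inj₁ (_ , inj₂ s)) (inj₂ (refl , _)) = ⊥-elim (step-irrefl s)
    colour-sym _ _ (inj₂ (refl , _)) (inj₁ (_ , inj₁ s)) = ⊥-elim (step-irrefl s)
    colour-sym _ _ (inj₂ (refl , _)) (inj₁ (_ , inj₂ s)) = ⊥-elim (step-irrefl s)
    colour-sym (i , j) _ (inj₂ (refl , inj₁ p)) (inj₂ (_ , inj₂ _)) =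
      trans (κ-ver (toℕ i) (toℕ j)) (cong (λ r → κ r (toℕ j) U) (sym p))
    colour-sym (i , j) (i′ , _) (inj₂ (refl , inj₂ p)) (inj₂ (_ , inj₁ _)) =
      trans (cong (λ r → κ r (toℕ j) U) p) (sym (κ-ver (toℕ i′) (toℕ j)))
    colour-sym _ _ (inj₂ (refl , inj₁ p)) (inj₂ (_ , inj₁ q)) = ⊥-elim (m+1+n≢n 1 (sym (trans q (cong suc p))))
    colour-sym _ _ (inj₂ (refl , inj₂ p)) (inj₂ (_ , inj₂ q)) = ⊥-elim (m+1+n≢n 1 (sym (trans q (cong suc p))))

    colouring : EdgeColoring G
    colouring = record { col = colour ; col-sym = colour-sym }

    realise : ∀ u d → Present (row u) d → Σ (V G) λ v → Σ (Adj G u v) λ e → colour u v e ≡ κ (row u) (column u) d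
    realise u d present with neighbour u d present
    ... | v , e , refl = v , e , refl

    interval-colouring : ∀ t →
      (∀ u → Ranked (Present (row u)) (κ (row u) (column u))) →
      (∀ u d → Present (row u) d → 1 ≤ κ (row u) (column u) d × κ (row u) (column u) d ≤ t) →
      (∀ k → 1 ≤ k → k ≤ t → Σ (V G) λ u → Σ Dir λ d → Present (row u) d × κ (row u) (column u) d ≡ k) →
      HasIntervalColoring G t
    interval-colouring t ranked range onto = colouring , record
      { inRange  = λ u v e → range u (dir e) (dir-present u v e)
      ; allUsed  = used
      ; proper   = λ u v w e e′ same → dir-injective u v w e e′
                     (ranked-injective (ranked u) (dir e) (dir e′) (dir-present u v e) (dir-present u w e′) same)
      ; interval = filled }
      where
      used : ∀ k → 1 ≤ k → k ≤ t → Σ (V G) λ u → Σ (V G) λ v → Σ (Adj G u v) λ e → colour u v e ≡ k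
      used k 1≤k k≤t with onto k 1≤k k≤t
      ... | u , d , present , κ≡ with realise u d present
      ...   | v , e , c≡ = u , v , e , trans c≡ κ≡
      filled : ∀ u v w (e : Adj G u v) (e′ : Adj G u w) k → colour u v e ≤ k → k ≤ colour u w e′ →
               Σ (V G) λ x → Σ (Adj G u x) λ e″ → colour u x e″ ≡ k
      filled u v w e e′ k lo hi
        with ranked-interval (ranked u) (dir e) (dir e′) k (dir-present u v e) (dir-present u w e′) lo hi
      ... | d , present , κ≡ with realise u d present
      ...   | x , e″ , c≡ = x , e″ , trans c≡ κ≡

-- Row i lies in block ⌊ i /2⌋; it is the upper row of its block iff odd i.
odd : ℕ → Bool
odd zero          = false
odd (suc zero)    = true
odd (suc (suc i)) = odd i

lower-row : ∀ i → odd i ≡ false → i ≡ 2 * ⌊ i /2⌋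
lower-row zero          _   = refl
lower-row (suc (suc i)) par = trans (cong (2 +_) (lower-row i par)) (sym (*-suc 2 ⌊ i /2⌋))

upper-row : ∀ i → odd i ≡ true → i ≡ suc (2 * ⌊ i /2⌋)
upper-row (suc zero)    _   = refl
upper-row (suc (suc i)) par = trans (cong (2 +_) (upper-row i par)) (cong suc (sym (*-suc 2 ⌊ i /2⌋)))

row-step : ∀ i → (odd i ≡ false × odd (suc i) ≡ true × ⌊ suc i /2⌋ ≡ ⌊ i /2⌋)
               ⊎ (odd i ≡ true × odd (suc i) ≡ false × ⌊ suc i /2⌋ ≡ suc ⌊ i /2⌋)
row-step zero       = inj₁ (refl , refl , refl)
row-step (suc zero) = inj₂ (refl , refl , refl)
row-step (suc (suc i)) with row-step i
... | inj₁ (p , p′ , h) = inj₁ (p , p′ , cong suc h)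
... | inj₂ (p , p′ , h) = inj₂ (p , p′ , cong suc h)

block-double : ∀ q → ⌊ 2 * q /2⌋ ≡ q
block-double q = trans (cong ⌊_/2⌋ (cong (q +_) (+-identityʳ q))) (sym (n≡⌊n+n/2⌋ q))

block< : ∀ M i → i < 2 * M → ⌊ i /2⌋ < M
block< M i i<2M with odd i in par
... | false = *-cancelˡ-< 2 _ M (subst (_< 2 * M) (lower-row i par) i<2M)
... | true  = *-cancelˡ-< 2 _ M (<-trans (n<1+n _) (subst (_< 2 * M) (upper-row i par) i<2M))

lower-row-rung : ∀ M i → odd i ≡ false → i < 2 * M → suc i < 2 * M
lower-row-rung M i par i<2M = subst (λ r → suc r < 2 * M) (sym (lower-row i par))
  (subst (_≤ 2 * M) (*-suc 2 ⌊ i /2⌋) (*-monoʳ-≤ 2 (block< M i i<2M)))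

upper-row-rung : ∀ i → odd i ≡ true → 1 ≤ i
upper-row-rung i par = subst (1 ≤_) (sym (upper-row i par)) (s≤s z≤n)

lower-row-above : ∀ i → odd i ≡ false → 1 ≤ i → 1 ≤ ⌊ i /2⌋
lower-row-above i par 1≤i with ⌊ i /2⌋ in h
... | zero  = ⊥-elim (<-irrefl refl (subst (1 ≤_) (trans (lower-row i par) (cong (2 *_) h)) 1≤i))
... | suc _ = s≤s z≤n

upper-row-below : ∀ M i → odd i ≡ true → suc i < 2 * M → suc ⌊ i /2⌋ < M
upper-row-below M i par i+1<2M = *-cancelˡ-< 2 _ M
  (subst (_< 2 * M) (trans (cong suc (upper-row i par)) (sym (*-suc 2 ⌊ i /2⌋))) i+1<2M)

record Window (t₀ s cl cr cv : ℕ) : Set where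
  field
    order    : Arrangement
    at-left  : cl ≡ s + pos order 0F
    at-right : cr ≡ s + pos order 1F
    at-rung  : cv ≡ s + pos order 2F
    positive : 1 ≤ s
    fits     : s + 2 ≤ t₀

record Pattern (b t₀ : ℕ) : Set where
  field
    hor vert low : ℕ → ℕ
    window  : ∀ j → j < b → Window t₀ (low j) (hor (prevCol b j)) (hor j) (vert j)
    cover   : ∀ x → 1 ≤ x → x ≤ t₀ → Σ ℕ λ j → j < b × low j ≤ x × x ≤ low j + 2
    four≤t₀ : 4 ≤ t₀

undo-four : ∀ k x q → 4 ≤ k → k ∸ 4 ≡ x + 4 * q → k ≡ x + 4 * suc q
undo-four k x q 4≤k k-4≡ = begin
    k              ≡⟨ m∸n+n≡m 4≤k ⟨
    k ∸ 4 + 4      ≡⟨ cong (_+ 4) k-4≡ ⟩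
    x + 4 * q + 4  ≡⟨ one-more x q ⟩
    x + 4 * suc q  ∎
  where
  open ≡-Reasoning
  one-more : ∀ x q → x + 4 * q + 4 ≡ x + 4 * suc q
  one-more = solve-∀

decompose : ∀ t₀ → 4 ≤ t₀ → ∀ K k → 1 ≤ k → k ≤ t₀ + 4 * K →
            Σ ℕ λ q → q ≤ K × Σ ℕ λ x → 1 ≤ x × x ≤ t₀ × k ≡ x + 4 * q
decompose t₀ 4≤t₀ K k 1≤k k≤ with k ≤? t₀
... | yes k≤t₀ = 0 , z≤n , k , 1≤k , k≤t₀ , sym (+-identityʳ k)
decompose t₀ 4≤t₀ zero    k 1≤k k≤ | no k≰t₀ = ⊥-elim (k≰t₀ (subst (k ≤_) (+-identityʳ t₀) k≤))
decompose t₀ 4≤t₀ (suc K) k 1≤k k≤ | no k≰t₀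
  with decompose t₀ 4≤t₀ K (k ∸ 4) (∸-monoˡ-≤ 4 5≤k)
         (subst (k ∸ 4 ≤_) (m+n∸n≡m (t₀ + 4 * K) 4) (∸-monoˡ-≤ 4 (subst (k ≤_) (four-more t₀ K) k≤)))
  where
  5≤k : 5 ≤ k
  5≤k = ≤-trans (s≤s 4≤t₀) (≰⇒> k≰t₀)
  four-more : ∀ t K → t + 4 * suc K ≡ t + 4 * K + 4
  four-more = solve-∀
... | q , q≤K , x , 1≤x , x≤t₀ , k-4≡ =
  suc q , s≤s q≤K , x , 1≤x , x≤t₀ , undo-four k x q (≤-trans 4≤t₀ (<⇒≤ (≰⇒> k≰t₀))) k-4≡

in-range : ∀ t₀ K c s h r → suc c ≡ s + 4 * h + r → 1 ≤ s → s + 2 ≤ t₀ →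
           1 ≤ 4 * h + r → 4 * h + r ≤ 4 * K + 3 → 1 ≤ c × c ≤ t₀ + 4 * K
in-range t₀ K c s h r c≡ 1≤s fits 1≤w w≤ =
  s≤s⁻¹ (subst (2 ≤_) (sym c≡′) (+-mono-≤ 1≤s 1≤w)) ,
  s≤s⁻¹ (begin
    suc c                   ≡⟨ c≡′ ⟩
    s + (4 * h + r)         ≤⟨ +-monoʳ-≤ s w≤ ⟩
    s + (4 * K + 3)         ≡⟨ regroup s K ⟩
    s + 2 + suc (4 * K)     ≤⟨ +-monoˡ-≤ (suc (4 * K)) fits ⟩
    t₀ + suc (4 * K)        ≡⟨ +-suc t₀ (4 * K) ⟩
    suc (t₀ + 4 * K)        ∎)
  where
  open ≤-Reasoning
  c≡′ : suc c ≡ s + (4 * h + r)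
  c≡′ = trans c≡ (+-assoc s (4 * h) r)
  regroup : ∀ s K → s + (4 * K + 3) ≡ s + 2 + suc (4 * K)
  regroup = solve-∀

shift : ∀ s x h → suc (s + x + 4 * h) ≡ s + 4 * h + suc x
shift = solve-∀

module Stacking (b′ t₀ : ℕ) (P : Pattern (suc (suc (suc b′))) t₀) (m′ : ℕ) where
  open Pattern P
  open CylinderGeometry (2 * suc m′) b′

  order : ∀ j → j < b → Arrangement
  order j jb = Window.order (window j jb)

  block-colour : ℕ → Bool → ℕ → Dir → ℕ
  block-colour h _     j L = hor (prevCol b j) + 4 * h
  block-colour h _     j R = hor j + 4 * h
  block-colour h false j D = vert j + 4 * h
  block-colour h true  j U = vert j + 4 * h
  block-colour h true  j D = low j + 4 * h + 3
  block-colour h false j U = low j + 4 * pred h + 3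

  κ : ℕ → ℕ → Dir → ℕ
  κ i j d = block-colour ⌊ i /2⌋ (odd i) j d

  κ-hor : ∀ i (j j′ : Fin b) → CycStep b j j′ → κ i (toℕ j) R ≡ κ i (toℕ j′) L
  κ-hor i j j′ s = cong (λ c → hor c + 4 * ⌊ i /2⌋) (sym (step-prev s))

  κ-ver : ∀ i j → κ i j D ≡ κ (suc i) j U
  κ-ver i j with row-step i
  ... | inj₁ (lower , upper , same) rewrite lower | upper | same = refl
  ... | inj₂ (upper , lower , next) rewrite upper | lower | next = refl

  block-rank : ∀ h p j (jb : j < b) d → (p ≡ false → d ≡ U → 1 ≤ h) →
               suc (block-colour h p j d) ≡ low j + 4 * h + rank p (order j jb) d
  block-rank h _ j jb L _ =
    trans (cong (λ c → suc (c + 4 * h)) (Window.at-left (window j jb))) (shift (low j) _ h)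
  block-rank h _ j jb R _ =
    trans (cong (λ c → suc (c + 4 * h)) (Window.at-right (window j jb))) (shift (low j) _ h)
  block-rank h false j jb D _ =
    trans (cong (λ c → suc (c + 4 * h)) (Window.at-rung (window j jb))) (shift (low j) _ h)
  block-rank h true j jb U _ =
    trans (cong (λ c → suc (c + 4 * h)) (Window.at-rung (window j jb))) (shift (low j) _ h)
  block-rank h true j jb D _ = top (low j) h
    where
    top : ∀ s h → suc (s + 4 * h + 3) ≡ s + 4 * h + 4
    top = solve-∀
  block-rank zero false j jb U above = ⊥-elim (<-irrefl refl (above refl refl))
  block-rank (suc h) false j jb U _ = bottom (low j) h
    where
    bottom : ∀ s h → suc (s + 4 * h + 3) ≡ s + 4 * suc h + 0
    bottom = solve-∀

  -- Outer edges going up only exist outside block 0, so the formula holds at every present edge.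
  κ-rank : ∀ i j (jb : j < b) d → Present i d → suc (κ i j d) ≡ low j + 4 * ⌊ i /2⌋ + rank (odd i) (order j jb) d
  κ-rank i j jb d present =
    block-rank ⌊ i /2⌋ (odd i) j jb d (λ par d≡U → lower-row-above i par (subst (Present i) d≡U present))

  -- The rung of every vertex exists, which makes its ranks gap-free.
  rung-present : ∀ i → i < 2 * suc m′ → Present i (slotDir (odd i) 2F)
  rung-present i i< with odd i in par
  ... | false = lower-row-rung (suc m′) i par i<
  ... | true  = upper-row-rung i par

  ranked : ∀ i j → i < 2 * suc m′ → j < b → Ranked (Present i) (κ i j)
  ranked i j i< jb = record
    { base           = low j + 4 * ⌊ i /2⌋
    ; rank           = rank (odd i) (order j jb)
    ; injective      = rank-injective (odd i) (order j jb)
    ; convex         = rank-convex (odd i) (order j jb) (Present i) tt tt (rung-present i i<)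
    ; colour-rank    = κ-rank i j jb }

  rank-window : ∀ i j → i < 2 * suc m′ → (jb : j < b) → ∀ d → Present i d →
                1 ≤ 4 * ⌊ i /2⌋ + rank (odd i) (order j jb) d × 4 * ⌊ i /2⌋ + rank (odd i) (order j jb) d ≤ 4 * m′ + 3
  rank-window i j i< jb d present = lower (rank-lower (odd i) π d) , upper (rank-upper (odd i) π d)
    where
    π : Arrangement
    π = order j jb
    lower : 1 ≤ rank (odd i) π d ⊎ (odd i ≡ false × d ≡ U) → 1 ≤ 4 * ⌊ i /2⌋ + rank (odd i) π d
    lower (inj₁ 1≤r)          = ≤-trans 1≤r (m≤n+m _ _)
    lower (inj₂ (par , refl)) =
      ≤-trans (s≤s z≤n) (≤-trans (*-monoʳ-≤ 4 (lower-row-above i par present)) (m≤m+n _ _))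
    upper : rank (odd i) π d ≤ 3 ⊎ (odd i ≡ true × d ≡ D) → 4 * ⌊ i /2⌋ + rank (odd i) π d ≤ 4 * m′ + 3
    upper (inj₁ r≤3) = +-mono-≤ (*-monoʳ-≤ 4 (s≤s⁻¹ (block< (suc m′) i i<))) r≤3
    upper (inj₂ (par , refl)) rewrite par = ≤-trans
      (≤-reflexive (sym (trans (*-suc 4 ⌊ i /2⌋) (+-comm 4 _))))
      (≤-trans (*-monoʳ-≤ 4 (s≤s⁻¹ (upper-row-below (suc m′) i par present))) (m≤m+n _ 3))

  κ-range : ∀ i j → i < 2 * suc m′ → j < b → ∀ d → Present i d → 1 ≤ κ i j d × κ i j d ≤ t₀ + 4 * m′
  κ-range i j i< jb d present =
    in-range t₀ m′ (κ i j d) (low j) ⌊ i /2⌋ _ (κ-rank i j jb d present)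
      (Window.positive (window j jb)) (Window.fits (window j jb))
      (proj₁ (rank-window i j i< jb d present)) (proj₂ (rank-window i j i< jb d present))

  -- Colour x + 4q, x in the window of column j, sits on a slot edge at (2q, j).
  every-colour : ∀ k → 1 ≤ k → k ≤ t₀ + 4 * m′ →
                 Σ ℕ λ i → Σ ℕ λ j → i < 2 * suc m′ × j < b × Σ Dir λ d → Present i d × κ i j d ≡ k
  every-colour k 1≤k k≤ with decompose t₀ four≤t₀ m′ k 1≤k k≤
  ... | q , q≤m′ , x , 1≤x , x≤t₀ , k≡ with cover x 1≤x x≤t₀
  ...   | j , jb , low≤x , x≤low+2 = 2 * q , j , i< , jb , slotDir (odd (2 * q)) sl , present , suc-injective (begin
      suc (κ (2 * q) j (slotDir (odd (2 * q)) sl))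
        ≡⟨ κ-rank (2 * q) j jb _ present ⟩
      low j + 4 * ⌊ 2 * q /2⌋ + rank (odd (2 * q)) π (slotDir (odd (2 * q)) sl)
        ≡⟨ cong₂ (λ h r → low j + 4 * h + r) (block-double q) (slot-rank (odd (2 * q)) π sl) ⟩
      low j + 4 * q + suc (pos π sl)
        ≡⟨ cong (λ o → low j + 4 * q + suc o) (proj₂ (slot-at π (x ∸ low j) o<3)) ⟩
      low j + 4 * q + suc (x ∸ low j)
        ≡⟨ shift (low j) (x ∸ low j) q ⟨
      suc (low j + (x ∸ low j) + 4 * q)
        ≡⟨ cong (λ y → suc (y + 4 * q)) (m+[n∸m]≡n low≤x) ⟩
      suc (x + 4 * q)
        ≡⟨ cong suc k≡ ⟨
      suc k ∎)
    where
    open ≡-Reasoning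
    i< : 2 * q < 2 * suc m′
    i< = *-monoʳ-< 2 (s≤s q≤m′)
    π : Arrangement
    π = order j jb
    o<3 : x ∸ low j < 3
    o<3 = s≤s (m≤n+o⇒m∸n≤o x (low j) x≤low+2)
    sl : Fin 3
    sl = proj₁ (slot-at π (x ∸ low j) o<3)
    present : Present (2 * q) (slotDir (odd (2 * q)) sl)
    present = slot-present (odd (2 * q)) (Present (2 * q)) tt tt (rung-present (2 * q) i<) sl

  open DirectionColouring κ κ-hor κ-ver

  stacked : HasIntervalColoring (Cyl (2 * suc m′) b) (t₀ + 4 * m′)
  stacked = interval-colouring (t₀ + 4 * m′)
    (λ u → ranked (row u) (column u) (toℕ<n (proj₁ u)) (toℕ<n (proj₂ u)))
    (λ u → κ-range (row u) (column u) (toℕ<n (proj₁ u)) (toℕ<n (proj₂ u)))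
    onto
    where
    onto : ∀ k → 1 ≤ k → k ≤ t₀ + 4 * m′ → Σ (V G) λ u → Σ Dir λ d → Present (row u) d × κ (row u) (column u) d ≡ k
    onto k 1≤k k≤ with every-colour k 1≤k k≤
    ... | i , j , i< , jb , d , present , κ≡ =
      (fromℕ< i< , fromℕ< jb) , d ,
      subst (λ r → Present r d) (sym (toℕ-fromℕ< i<)) present ,
      trans (cong₂ (λ r c → κ r c d) (toℕ-fromℕ< i<) (toℕ-fromℕ< jb)) κ≡

stacking : ∀ b t₀ → 3 ≤ b → Pattern b t₀ → ∀ m′ → HasIntervalColoring (Cyl (2 * suc m′) b) (t₀ + 4 * m′)
stacking (suc (suc (suc b′))) t₀ (s≤s (s≤s (s≤s z≤n))) P m′ = Stacking.stacked b′ t₀ P m′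

tent : ℕ → (ℕ → ℕ) → (ℕ → ℕ) → ℕ → ℕ
tent c f g j = if j <ᵇ c then f j else g j

tent-below : ∀ c f g {j} → j < c → tent c f g j ≡ f j
tent-below c f g {j} j<c with j <ᵇ c in eq
... | true  = refl
... | false = ⊥-elim (subst T eq (<⇒<ᵇ j<c))

tent-above : ∀ c f g {j} → c ≤ j → tent c f g j ≡ g j
tent-above c f g {j} c≤j with j <ᵇ c in eq
... | true  = ⊥-elim (<⇒≱ (<ᵇ⇒< j c (subst T (sym eq) tt)) c≤j)
... | false = refl

retarget : ∀ {t₀ s cl cr cv s′ cl′ cr′ cv′} → s ≡ s′ → cl ≡ cl′ → cr ≡ cr′ → cv ≡ cv′ →
           Window t₀ s′ cl′ cr′ cv′ → Window t₀ s cl cr cv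
retarget refl refl refl refl w = w

minus : ∀ x y z → x ≡ y + z → x ∸ y ≡ z
minus x y z x≡ = trans (cong (_∸ y) x≡) (m+n∸m≡n y z)

first-window : ∀ t₀ → 3 ≤ t₀ → Window t₀ 1 3 2 1
first-window t₀ 3≤t₀ = record
  { order = reverse ; at-left = refl ; at-right = refl ; at-rung = refl
  ; positive = s≤s z≤n ; fits = 3≤t₀ }

ascending-window : ∀ t₀ p → 2 * suc p + 2 ≤ t₀ →
                   Window t₀ (2 * suc p) (2 * p + 2) (2 * suc p + 2) (2 * suc p + 1)
ascending-window t₀ p fits = record
  { order = transpose 1F 2F ; at-left = e p ; at-right = refl ; at-rung = refl
  ; positive = s≤s z≤n ; fits = fits }
  where
  e : ∀ p → 2 * p + 2 ≡ 2 * suc p + 0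
  e = solve-∀

descending-window : ∀ t₀ e → 2 * e + 1 + 2 ≤ t₀ →
                    Window t₀ (2 * e + 1) (2 * suc e + 1) (2 * e + 1) (2 * e + 2)
descending-window t₀ e fits = record
  { order = transpose 0F 1F ∘ₚ transpose 1F 2F ; at-left = e₁ e ; at-right = sym (+-identityʳ _)
  ; at-rung = e₂ e ; positive = m≤n+m 1 (2 * e) ; fits = fits }
  where
  e₁ : ∀ e → 2 * suc e + 1 ≡ 2 * e + 1 + 2
  e₁ = solve-∀
  e₂ : ∀ e → 2 * e + 2 ≡ 2 * e + 1 + 1
  e₂ = solve-∀

data ColumnView (c : ℕ) : ℕ → Set where
  first      : ColumnView c 0
  ascending  : ∀ p → suc p < c → ColumnView c (suc p)
  middle     : ∀ p → suc p ≡ c → ColumnView c (suc p)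
  descending : ∀ p → c < suc p → ColumnView c (suc p)

columnView : ∀ c j → ColumnView c j
columnView c zero = first
columnView c (suc p) with <-cmp (suc p) c
... | tri< lt _ _ = ascending p lt
... | tri≈ _ eq _ = middle p eq
... | tri> _ _ gt = descending p gt

-- Both patterns (b = 2n and b = 2n + 1, n = n₁ + 1) rise along the columns
-- 0, …, n with windows starting at 1, 2, 4, …, 2n and fall back towards
-- column b - 1 with windows starting at 2(b - j) + 1.
module Ladder (n₁ b : ℕ) where

  n : ℕ
  n = suc n₁

  a-hor a-vert a-low d-hor d-vert : ℕ → ℕ
  a-hor  j = 2 * j + 2
  a-vert j = 2 * j + 1
  a-low  j = 2 * j
  d-hor  j = 2 * (b ∸ j) + 1
  d-vert j = 2 * (b ∸ j) + 2

  low : ℕ → ℕ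
  low zero    = 1
  low (suc j) = tent (suc n) a-low d-hor (suc j)

  low-ascending : ∀ p → suc p ≤ n → low (suc p) ≡ 2 * suc p
  low-ascending p p+1≤n = tent-below (suc n) a-low d-hor (s≤s p+1≤n)

  low-descending : ∀ p → n < suc p → low (suc p) ≡ d-hor (suc p)
  low-descending p n<p+1 = tent-above (suc n) a-low d-hor n<p+1

  low-cover : ∀ c → c ≤ n → ∀ x → 1 ≤ x → x ≤ 2 * c + 2 → Σ ℕ λ j → j ≤ c × low j ≤ x × x ≤ low j + 2
  low-cover zero    _   x 1≤x x≤2 = 0 , z≤n , 1≤x , m≤n⇒m≤1+n x≤2
  low-cover (suc c) c<n x 1≤x x≤ with x ≤? 2 * c + 2
  ... | yes x≤′ with low-cover c (m≤n⇒m≤1+n (s≤s⁻¹ c<n)) x 1≤x x≤′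
  ...   | j , j≤c , found = j , m≤n⇒m≤1+n j≤c , found
  low-cover (suc c) c<n x 1≤x x≤ | no x≰′ =
    suc c , ≤-refl ,
    subst (_≤ x) (sym (low-ascending c c<n)) (≤-trans (≤-reflexive (e c)) (<⇒≤ (≰⇒> x≰′))) ,
    subst (λ l → x ≤ l + 2) (sym (low-ascending c c<n)) x≤
    where
    e : ∀ c → 2 * suc c ≡ 2 * c + 2
    e = solve-∀

  d-hor-last : 1 ≤ b → d-hor (b ∸ 1) ≡ 3
  d-hor-last 1≤b = cong (λ z → 2 * z + 1) (m∸[m∸n]≡n 1≤b)

  ascending-fits : ∀ p → suc p ≤ n → 2 * suc p + 2 ≤ 2 * n + 2
  ascending-fits p p+1≤n = +-monoˡ-≤ 2 (*-monoʳ-≤ 2 p+1≤n)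

  descending-fits : ∀ e → e ≤ n₁ → 2 * e + 1 + 2 ≤ 2 * n + 2
  descending-fits e e≤n₁ =
    ≤-trans (+-monoˡ-≤ 2 (+-monoˡ-≤ 1 (*-monoʳ-≤ 2 e≤n₁))) (≤-trans (n≤1+n _) (≤-reflexive (sym (e₁ n₁))))
    where
    e₁ : ∀ n₁ → 2 * suc n₁ + 2 ≡ suc (2 * n₁ + 1 + 2)
    e₁ = solve-∀

  descending-column : ∀ t₀ p → suc p ≤ b → 2 * (b ∸ suc p) + 1 + 2 ≤ t₀ →
                   Window t₀ (d-hor (suc p)) (d-hor p) (d-hor (suc p)) (d-vert (suc p))
  descending-column t₀ p p<b fits =
    retarget refl (cong (λ z → 2 * z + 1) (+-∸-assoc 1 p<b)) refl refl (descending-window t₀ (b ∸ suc p) fits)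

-- The pattern for b = 2n: horizontal colours 2, 4, …, 2n, 2n+1, 2n-1, …, 3
-- and rung colours 1, 3, …, 2n-1, 2n+2, 2n, …, 4; here t₀ = 2n + 2.
module EvenPattern (n₁ : ℕ) where

  b : ℕ
  b = 2 * suc n₁

  open Ladder n₁ b

  t₀ : ℕ
  t₀ = 2 * n + 2

  4≤t₀ : 4 ≤ t₀
  4≤t₀ = ≤-trans (m≤n+m 4 (2 * n₁)) (≤-reflexive (e n₁))
    where
    e : ∀ n₁ → 2 * n₁ + 4 ≡ 2 * suc n₁ + 2
    e = solve-∀

  hor vert : ℕ → ℕ
  hor  = tent n a-hor d-hor
  vert = tent n a-vert d-vert

  n≤b-1 : n ≤ b ∸ 1
  n≤b-1 = subst (n ≤_) (sym (minus b 1 (n + n₁) (e n₁))) (m≤m+n n n₁)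
    where
    e : ∀ n₁ → 2 * suc n₁ ≡ 1 + (suc n₁ + n₁)
    e = solve-∀

  b-n : b ∸ n ≡ n
  b-n = minus b n n (e n₁)
    where
    e : ∀ n₁ → 2 * suc n₁ ≡ suc n₁ + suc n₁
    e = solve-∀

  b-n-1 : b ∸ suc n ≡ n₁
  b-n-1 = minus b (suc n) n₁ (e n₁)
    where
    e : ∀ n₁ → 2 * suc n₁ ≡ suc (suc n₁) + n₁
    e = solve-∀

  middle-window : Window t₀ (2 * n) (2 * n₁ + 2) (2 * n + 1) (2 * n + 2)
  middle-window = record
    { order = id ; at-left = e n₁ ; at-right = refl ; at-rung = refl
    ; positive = s≤s z≤n ; fits = ≤-refl }
    where
    e : ∀ n₁ → 2 * n₁ + 2 ≡ 2 * suc n₁ + 0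
    e = solve-∀

  window : ∀ j → j < b → Window t₀ (low j) (hor (prevCol b j)) (hor j) (vert j)
  window j j<b with columnView n j
  ... | first = retarget refl
          (trans (tent-above n a-hor d-hor n≤b-1) (d-hor-last (s≤s z≤n)))
          (tent-below n a-hor d-hor (s≤s z≤n)) (tent-below n a-vert d-vert (s≤s z≤n))
          (first-window t₀ (≤-trans (n≤1+n 3) 4≤t₀))
  ... | ascending p p+1<n = retarget (low-ascending p (<⇒≤ p+1<n))
          (tent-below n a-hor d-hor (<-trans (n<1+n p) p+1<n))
          (tent-below n a-hor d-hor p+1<n) (tent-below n a-vert d-vert p+1<n)
          (ascending-window t₀ p (ascending-fits p (<⇒≤ p+1<n)))
  ... | middle p refl = retarget (low-ascending n₁ ≤-refl) (tent-below n a-hor d-hor ≤-refl)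
          (trans (tent-above n a-hor d-hor ≤-refl) (cong (λ z → 2 * z + 1) b-n))
          (trans (tent-above n a-vert d-vert ≤-refl) (cong (λ z → 2 * z + 2) b-n))
          middle-window
  ... | descending p n<p+1 = retarget (low-descending p n<p+1)
          (tent-above n a-hor d-hor (s≤s⁻¹ n<p+1))
          (tent-above n a-hor d-hor (<⇒≤ n<p+1)) (tent-above n a-vert d-vert (<⇒≤ n<p+1))
          (descending-column t₀ p (<⇒≤ j<b) (descending-fits (b ∸ suc p)
            (subst (b ∸ suc p ≤_) b-n-1 (∸-monoʳ-≤ b n<p+1))))

  -- The windows of columns 0, …, n already cover [1, 2n + 2].
  even-pattern : Pattern b t₀
  even-pattern = record
    { hor = hor ; vert = vert ; low = low ; window = window
    ; cover = λ x 1≤x x≤t₀ → let (j , j≤n , found) = low-cover n ≤-refl x 1≤x x≤t₀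
                              in j , ≤-<-trans j≤n n<b , found
    ; four≤t₀ = 4≤t₀ }
    where
    n<b : n < b
    n<b = m<m+n n (s≤s z≤n)

-- The pattern for b = 2n + 1: horizontal colours 2, 4, …, 2n+2, 2n+1, …, 3
-- and rung colours 1, 3, …, 2n+3, 2n, …, 4; here t₀ = 2n + 3.
module OddPattern (n₁ : ℕ) where

  b : ℕ
  b = 2 * suc n₁ + 1

  open Ladder n₁ b

  t₀ : ℕ
  t₀ = 2 * n + 3

  4≤t₀ : 4 ≤ t₀
  4≤t₀ = ≤-trans (m≤n+m 4 (2 * n₁ + 1)) (≤-reflexive (e n₁))
    where
    e : ∀ n₁ → 2 * n₁ + 1 + 4 ≡ 2 * suc n₁ + 3
    e = solve-∀

  below-t₀ : ∀ {x} → x ≤ 2 * n + 2 → x ≤ t₀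
  below-t₀ x≤ = ≤-trans x≤ (+-monoʳ-≤ (2 * n) (n≤1+n 2))

  hor vert : ℕ → ℕ
  hor  = tent (suc n) a-hor d-hor
  vert = tent (suc (suc n)) a-vert d-vert

  n+1≤b-1 : suc n ≤ b ∸ 1
  n+1≤b-1 = subst (suc n ≤_) (sym (minus b 1 (suc n + n₁) (e n₁))) (m≤m+n (suc n) n₁)
    where
    e : ∀ n₁ → 2 * suc n₁ + 1 ≡ 1 + (suc (suc n₁) + n₁)
    e = solve-∀

  b-n-1 : b ∸ suc n ≡ n
  b-n-1 = minus b (suc n) n (e n₁)
    where
    e : ∀ n₁ → 2 * suc n₁ + 1 ≡ suc (suc n₁) + suc n₁
    e = solve-∀

  b≡ : b ≡ suc (suc n) + n₁
  b≡ = e n₁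
    where
    e : ∀ n₁ → 2 * suc n₁ + 1 ≡ suc (suc (suc n₁)) + n₁
    e = solve-∀

  b-n-2 : b ∸ suc (suc n) ≡ n₁
  b-n-2 = minus b (suc (suc n)) n₁ b≡

  n+1<b : suc n < b
  n+1<b = subst (suc (suc n) ≤_) (sym b≡) (m≤m+n _ n₁)

  middle-window : Window t₀ (2 * n + 1) (2 * n + 2) (2 * n + 1) (2 * suc n + 1)
  middle-window = record
    { order = transpose 0F 1F ; at-left = e₁ n ; at-right = sym (+-identityʳ _) ; at-rung = e₂ n
    ; positive = m≤n+m 1 (2 * n) ; fits = ≤-reflexive (sym (e₃ n)) }
    where
    e₁ : ∀ n → 2 * n + 2 ≡ 2 * n + 1 + 1
    e₁ = solve-∀
    e₂ : ∀ n → 2 * suc n + 1 ≡ 2 * n + 1 + 2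
    e₂ = solve-∀
    e₃ : ∀ n → 2 * n + 3 ≡ 2 * n + 1 + 2
    e₃ = solve-∀

  window : ∀ j → j < b → Window t₀ (low j) (hor (prevCol b j)) (hor j) (vert j)
  window j j<b with columnView (suc n) j
  ... | first = retarget refl
          (trans (tent-above (suc n) a-hor d-hor n+1≤b-1) (d-hor-last (s≤s z≤n)))
          (tent-below (suc n) a-hor d-hor (s≤s z≤n)) (tent-below (suc (suc n)) a-vert d-vert (s≤s z≤n))
          (first-window t₀ (≤-trans (n≤1+n 3) 4≤t₀))
  ... | ascending p p+1<n+1 = retarget (low-ascending p (s≤s⁻¹ p+1<n+1))
          (tent-below (suc n) a-hor d-hor (<-trans (n<1+n p) p+1<n+1))
          (tent-below (suc n) a-hor d-hor p+1<n+1)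
          (tent-below (suc (suc n)) a-vert d-vert (<-trans p+1<n+1 (n<1+n _)))
          (ascending-window t₀ p (below-t₀ (ascending-fits p (s≤s⁻¹ p+1<n+1))))
  ... | middle p refl = retarget
          (trans (low-descending n ≤-refl) (cong (λ z → 2 * z + 1) b-n-1))
          (tent-below (suc n) a-hor d-hor ≤-refl)
          (trans (tent-above (suc n) a-hor d-hor ≤-refl) (cong (λ z → 2 * z + 1) b-n-1))
          (tent-below (suc (suc n)) a-vert d-vert ≤-refl)
          middle-window
  ... | descending p n+1<p+1 = retarget (low-descending p (<-trans (n<1+n n) n+1<p+1))
          (tent-above (suc n) a-hor d-hor (s≤s⁻¹ n+1<p+1))
          (tent-above (suc n) a-hor d-hor (<⇒≤ n+1<p+1)) (tent-above (suc (suc n)) a-vert d-vert n+1<p+1)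
          (descending-column t₀ p (<⇒≤ j<b) (below-t₀ (descending-fits (b ∸ suc p)
            (subst (b ∸ suc p ≤_) b-n-2 (∸-monoʳ-≤ b n+1<p+1)))))

  -- Colours up to 2n + 2 lie in the windows of columns 0, …, n, colour 2n + 3 in that of column n + 1.
  odd-pattern : Pattern b t₀
  odd-pattern = record
    { hor = hor ; vert = vert ; low = low ; window = window ; cover = cover ; four≤t₀ = 4≤t₀ }
    where
    cover : ∀ x → 1 ≤ x → x ≤ t₀ → Σ ℕ λ j → j < b × low j ≤ x × x ≤ low j + 2
    cover x 1≤x x≤t₀ with x ≤? 2 * n + 2
    ... | yes x≤ = let (j , j≤n , found) = low-cover n ≤-refl x 1≤x x≤
                   in j , ≤-<-trans j≤n (<-trans (n<1+n n) n+1<b) , found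
    ... | no x≰ = suc n , n+1<b ,
          subst (_≤ x) (sym low-middle) (≤-trans (+-monoʳ-≤ (2 * n) (n≤1+n 1)) (<⇒≤ (≰⇒> x≰))) ,
          subst (λ l → x ≤ l + 2) (sym low-middle) (subst (x ≤_) (e n) x≤t₀)
      where
      low-middle : low (suc n) ≡ 2 * n + 1
      low-middle = trans (low-descending n ≤-refl) (cong (λ z → 2 * z + 1) b-n-1)
      e : ∀ n → 2 * n + 3 ≡ 2 * n + 1 + 2
      e = solve-∀

colourable-with-bound : ∀ {G t k} → HasIntervalColoring G t → 1 ≤ t → k ≤ t → IntervalColorable G × W≥ G k
colourable-with-bound {t = t} c 1≤t k≤t = (t , 1≤t , c) , (t , k≤t , c)

theorem17 : (∀ (m n : ℕ) → 1 ≤ m → 2 ≤ n →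
                IntervalColorable (Cyl (2 * m) (2 * n)) ×
                W≥ (Cyl (2 * m) (2 * n)) (4 * m + 2 * n ∸ 2))
              ×
              (∀ (m n : ℕ) → 1 ≤ m → 1 ≤ n →
                IntervalColorable (Cyl (2 * m) (2 * n + 1)) ×
                W≥ (Cyl (2 * m) (2 * n + 1)) (4 * m + 2 * n ∸ 1))
theorem17 = even-cylinders , odd-cylinders
  where
  -- C(2m, 2n) with the even pattern: 2n + 2 + 4(m - 1) = 4m + 2n - 2 colours.
  even-cylinders : ∀ m n → 1 ≤ m → 2 ≤ n → IntervalColorable (Cyl (2 * m) (2 * n)) × W≥ (Cyl (2 * m) (2 * n)) (4 * m + 2 * n ∸ 2)
  even-cylinders (suc m′) n@(suc n₁) _ 2≤n = colourable-with-bound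
    (stacking (2 * n) (2 * n + 2) (≤-trans (n≤1+n 3) (*-monoʳ-≤ 2 2≤n)) (EvenPattern.even-pattern n₁) m′)
    (s≤s z≤n) (≤-reflexive (minus _ 2 _ (count m′ n)))
    where
    count : ∀ m′ n → 4 * suc m′ + 2 * n ≡ 2 + (2 * n + 2 + 4 * m′)
    count = solve-∀
  -- C(2m, 2n + 1) with the odd pattern: 2n + 3 + 4(m - 1) = 4m + 2n - 1 colours.
  odd-cylinders : ∀ m n → 1 ≤ m → 1 ≤ n → IntervalColorable (Cyl (2 * m) (2 * n + 1)) × W≥ (Cyl (2 * m) (2 * n + 1)) (4 * m + 2 * n ∸ 1)
  odd-cylinders (suc m′) n@(suc n₁) _ 1≤n = colourable-with-bound
    (stacking (2 * n + 1) (2 * n + 3) (+-monoˡ-≤ 1 (*-monoʳ-≤ 2 1≤n)) (OddPattern.odd-pattern n₁) m′)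
    (s≤s z≤n) (≤-reflexive (minus _ 1 _ (count m′ n)))
    where
    count : ∀ m′ n → 4 * suc m′ + 2 * n ≡ 1 + (2 * n + 3 + 4 * m′)
    count = solve-∀
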